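{- For every integer $n\ge 0$ and every integer $k$ with $0\le k\le 2n$, we have $m_{n,k-n}=s_{n,k}$.
   Context: A Motzkin path is a lattice path starting at $(0,0)$ whose steps are $(1,0)$, $(1,1)$ or $(1,-1)$. It is not required to stay above the $x$-axis. It is peakless if no step $(1,1)$ is immediately followed by a step $(1,-1)$. $m_{a,b}$ denotes the number of peakless Motzkin paths from $(0,0)$ to $(a,b)$. A 0-1-2 sum with $n$ summands is a sequence $(e_1,\dots,e_n)$ with each $e_i\in\{0,1,2\}$ such that whenever $e_i=2$ and $i<n$ we have $e_{i+1}\ne0$. Its value is $\sum e_i$. $s_{n,k}$ is the number of 0-1-2 sums with $n$ summands and value $k$. -}

module Defs where

open import Data.Nat using (ℕ; zero; suc; _+_)
open import Data.Integer using (ℤ; +_; -[1+_]) renaming (_+_ to _+ℤ_)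
open import Data.List using (List; []; _∷_; length; filter; concatMap; map)
open import Data.Bool using (Bool; true; false; _∧_; T)
open import Data.Unit using (⊤)
open import Data.Empty using (⊥)
open import Relation.Nullary using (Dec; yes; no; ¬_)
open import Relation.Nullary.Decidable using (T?)
open import Relation.Binary.PropositionalEquality using (_≡_)
open import Data.Integer.Properties renaming (_≟_ to _≟ℤ_) using ()
open import Data.Nat.Properties renaming (_≟_ to _≟ℕ_) using ()

-- Motzkin paths (not required to stay above the x-axis)

-- Steps: H = (1,0), U = (1,1), D = (1,-1)
data Step : Set where
  H U D : Step

-- A path of length n is a list of n steps; it starts at (0,0).
allSteps : List Step
allSteps = H ∷ U ∷ D ∷ []

words : {A : Set} → List A → ℕ → List (List A)
words xs zero = [] ∷ []
words xs (suc n) = concatMap (λ w → map (λ x → x ∷ w) xs) (words xs n)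

dy : Step → ℤ
dy H = + 0
dy U = + 1
dy D = -[1+ 0 ]

height : List Step → ℤ
height [] = + 0
height (s ∷ p) = dy s +ℤ height p

peaklessᵇ : List Step → Bool
peaklessᵇ [] = true
peaklessᵇ (U ∷ D ∷ p) = false
peaklessᵇ (_ ∷ p) = peaklessᵇ p

endsAtᵇ : ℤ → List Step → Bool
endsAtᵇ b p with height p ≟ℤ b
... | yes _ = true
... | no _ = false

-- m a b = number of peakless Motzkin paths from (0,0) to (a,b)
-- (a path to (a,b) has exactly a steps)
m : ℕ → ℤ → ℕ
m a b = length (filter (λ p → T? (peaklessᵇ p ∧ endsAtᵇ b p)) (words allSteps a))

data Digit : Set where
  d0 d1 d2 : Digit

allDigits : List Digit
allDigits = d0 ∷ d1 ∷ d2 ∷ []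

val : Digit → ℕ
val d0 = 0
val d1 = 1
val d2 = 2

value : List Digit → ℕ
value [] = 0
value (e ∷ es) = val e + value es

validᵇ : List Digit → Bool
validᵇ [] = true
validᵇ (d2 ∷ d0 ∷ es) = false
validᵇ (_ ∷ es) = validᵇ es

hasValueᵇ : ℕ → List Digit → Bool
hasValueᵇ k es with value es ≟ℕ k
... | yes _ = true
... | no _ = false

s : ℕ → ℕ → ℕ
s n k = length (filter (λ es → T? (validᵇ es ∧ hasValueᵇ k es)) (words allDigits n))

module Submission where

-- Relabel the steps of a path as digits, D ↦ 0, H ↦ 1, U ↦ 2 (the rise
-- plus one).  On words of length n this is a bijection under which a peak
-- U D becomes the forbidden pattern 2 0, and the value of the digit word is
-- the final height plus n.  So peakless paths ending at height k - n
-- correspond exactly to 0-1-2 sums of value k.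

open import Defs
open import Data.Nat using (ℕ; _≤_; _*_)
open import Data.Integer using (+_; _-_)
open import Relation.Binary.PropositionalEquality using (_≡_)

open import Data.Nat as ℕ using (zero; suc)
open import Data.Nat.ListAction using (sum)
open import Data.Nat.ListAction.Properties using (sum-++; sum-↭)
import Data.Nat.Properties as ℕP
open import Data.Integer using (ℤ) renaming (_+_ to _+ℤ_)
import Data.Integer.Properties as ℤP
open import Algebra.Properties.AbelianGroup ℤP.+-0-abelianGroup
  using (//-rightDividesˡ; //-rightDividesʳ)
open import Algebra.Properties.CommutativeSemigroup ℤP.+-commutativeSemigroup
  using (interchange)
open import Data.List using (List; []; _∷_; _++_; map; filter; length; concatMap)
open import Data.List.Properties using (map-++; map-cong; map-∘)
open import Data.List.Relation.Binary.Permutation.Propositional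
  using (_↭_; ↭-trans; ↭-prep; ↭-swap; ↭-refl)
open import Data.List.Relation.Binary.Permutation.Propositional.Properties using (map⁺)
open import Data.Bool using (Bool; true; false; _∧_; if_then_else_)
open import Function using (_∘_; _⇔_; mk⇔; Equivalence)
open import Relation.Nullary using (yes; no; contradiction)
open import Relation.Nullary.Decidable using (T?)
open import Relation.Binary.PropositionalEquality using (refl; cong; cong₂; sym; trans)
open Relation.Binary.PropositionalEquality.≡-Reasoning

indicator : {A : Set} → (A → Bool) → A → ℕ
indicator b x = if b x then 1 else 0

count≡sum-indicator : {A : Set} (b : A → Bool) (L : List A) →
  length (filter (λ x → T? (b x)) L) ≡ sum (map (indicator b) L)
count≡sum-indicator b [] = refl
count≡sum-indicator b (x ∷ L) with b x
... | true  = cong suc (count≡sum-indicator b L)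
... | false = count≡sum-indicator b L

sum-concatMap : {A B : Set} (F : B → ℕ) (g : A → List B) (L : List A) →
  sum (map F (concatMap g L)) ≡ sum (map (λ a → sum (map F (g a))) L)
sum-concatMap F g [] = refl
sum-concatMap F g (a ∷ L) = begin
    sum (map F (g a ++ concatMap g L))
  ≡⟨ cong sum (map-++ F (g a) (concatMap g L)) ⟩
    sum (map F (g a) ++ map F (concatMap g L))
  ≡⟨ sum-++ (map F (g a)) (map F (concatMap g L)) ⟩
    sum (map F (g a)) ℕ.+ sum (map F (concatMap g L))
  ≡⟨ cong (sum (map F (g a)) ℕ.+_) (sum-concatMap F g L) ⟩
    sum (map F (g a)) ℕ.+ sum (map (λ a → sum (map F (g a))) L)
  ∎

sum-words-suc : {A : Set} (xs : List A) (n : ℕ) (F : List A → ℕ) →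
  sum (map F (words xs (suc n)))
    ≡ sum (map (λ w → sum (map (λ x → F (x ∷ w)) xs)) (words xs n))
sum-words-suc xs n F = trans (sum-concatMap F _ (words xs n))
  (cong sum (map-cong (λ w → cong sum (sym (map-∘ xs))) (words xs n)))

sum-words-relabel : {A B : Set} (f : A → B) (xs : List A) (ys : List B) →
  map f xs ↭ ys → (n : ℕ) (F : List B → ℕ) →
  sum (map F (words ys n)) ≡ sum (map (F ∘ map f) (words xs n))
sum-words-relabel f xs ys fxs↭ys zero F = refl
sum-words-relabel {B = B} f xs ys fxs↭ys (suc n) F = begin
    sum (map F (words ys (suc n)))
  ≡⟨ sum-words-suc ys n F ⟩
    sum (map (λ w → sum (map (λ y → F (y ∷ w)) ys)) (words ys n))
  ≡⟨ sum-words-relabel f xs ys fxs↭ys n _ ⟩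
    sum (map (λ p → sum (map (λ y → F (y ∷ map f p)) ys)) (words xs n))
  ≡⟨ cong sum (map-cong (λ p → relabel-letters (λ y → F (y ∷ map f p))) (words xs n)) ⟩
    sum (map (λ p → sum (map (λ x → F (f x ∷ map f p)) xs)) (words xs n))
  ≡⟨ sym (sum-words-suc xs n (F ∘ map f)) ⟩
    sum (map (F ∘ map f) (words xs (suc n)))
  ∎
  where
  relabel-letters : (G : B → ℕ) → sum (map G ys) ≡ sum (map (G ∘ f) xs)
  relabel-letters G = trans (sym (sum-↭ (map⁺ G fxs↭ys))) (cong sum (sym (map-∘ xs)))

sum-words-cong : {A : Set} (xs : List A) (n : ℕ) (F G : List A → ℕ) →
  (∀ w → length w ≡ n → F w ≡ G w) →
  sum (map F (words xs n)) ≡ sum (map G (words xs n))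
sum-words-cong xs zero F G F≡G = cong (ℕ._+ 0) (F≡G [] refl)
sum-words-cong xs (suc n) F G F≡G = begin
    sum (map F (words xs (suc n)))
  ≡⟨ sum-words-suc xs n F ⟩
    sum (map (λ w → sum (map (λ x → F (x ∷ w)) xs)) (words xs n))
  ≡⟨ sum-words-cong xs n _ _ (λ w ∣w∣≡n →
       cong sum (map-cong (λ x → F≡G (x ∷ w) (cong suc ∣w∣≡n)) xs)) ⟩
    sum (map (λ w → sum (map (λ x → G (x ∷ w)) xs)) (words xs n))
  ≡⟨ sym (sum-words-suc xs n G) ⟩
    sum (map G (words xs (suc n)))
  ∎

toDigit : Step → Digit
toDigit H = d1
toDigit U = d2
toDigit D = d0

relabel-alphabet : map toDigit allSteps ↭ allDigits
relabel-alphabet = ↭-trans (↭-prep d1 (↭-swap d2 d0 ↭-refl)) (↭-swap d1 d0 ↭-refl)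

valid-relabel : ∀ p → validᵇ (map toDigit p) ≡ peaklessᵇ p
valid-relabel []           = refl
valid-relabel (H ∷ p)      = valid-relabel p
valid-relabel (D ∷ p)      = valid-relabel p
valid-relabel (U ∷ [])     = refl
valid-relabel (U ∷ H ∷ p)  = valid-relabel (H ∷ p)
valid-relabel (U ∷ U ∷ p)  = valid-relabel (U ∷ p)
valid-relabel (U ∷ D ∷ p)  = refl

value-relabel : ∀ p → + value (map toDigit p) ≡ height p +ℤ + length p
value-relabel [] = refl
value-relabel (s ∷ p) = begin
    + val (toDigit s) +ℤ + value (map toDigit p)
  ≡⟨ cong₂ _+ℤ_ (digit≡rise+1 s) (value-relabel p) ⟩
    (dy s +ℤ + 1) +ℤ (height p +ℤ + length p)
  ≡⟨ interchange (dy s) (+ 1) (height p) (+ length p) ⟩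
    (dy s +ℤ height p) +ℤ (+ 1 +ℤ + length p)
  ∎
  where
  digit≡rise+1 : ∀ s → + val (toDigit s) ≡ dy s +ℤ + 1
  digit≡rise+1 H = refl
  digit≡rise+1 U = refl
  digit≡rise+1 D = refl

minus-shift : (a b v k : ℤ) → a +ℤ b ≡ v → (a ≡ k - b) ⇔ (v ≡ k)
minus-shift a b v k a+b≡v = mk⇔
  (λ a≡k-b → trans (sym a+b≡v) (trans (cong (_+ℤ b) a≡k-b) (//-rightDividesˡ b k)))
  (λ v≡k → trans (sym (//-rightDividesʳ b a)) (cong (_- b) (trans a+b≡v v≡k)))

endsAt⇔value : ∀ k p →
  (height p ≡ + k - + length p) ⇔ (value (map toDigit p) ≡ k)
endsAt⇔value k p = mk⇔
  (ℤP.+-injective ∘ Equivalence.to heights⇔)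
  (Equivalence.from heights⇔ ∘ cong +_)
  where
  heights⇔ : (height p ≡ + k - + length p) ⇔ (+ value (map toDigit p) ≡ + k)
  heights⇔ = minus-shift _ _ _ (+ k) (sym (value-relabel p))

endsAt-relabel : ∀ k p → endsAtᵇ (+ k - + length p) p ≡ hasValueᵇ k (map toDigit p)
endsAt-relabel k p
  with height p ℤP.≟ (+ k - + length p) | value (map toDigit p) ℕP.≟ k
... | yes _ | yes _ = refl
... | no _  | no _  = refl
... | yes ends | no ¬hasValue = contradiction (Equivalence.to (endsAt⇔value k p) ends) ¬hasValue
... | no ¬ends | yes hasValue = contradiction (Equivalence.from (endsAt⇔value k p) hasValue) ¬ends

theorem5 : (n k : ℕ) → k ≤ 2 * n → m n (+ k - + n) ≡ s n k
theorem5 n k _ = begin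
    m n (+ k - + n)
  ≡⟨ count≡sum-indicator isCountedPath (words allSteps n) ⟩
    sum (map (indicator isCountedPath) (words allSteps n))
  ≡⟨ sum-words-cong allSteps n _ _ path≡digits ⟩
    sum (map (indicator isCountedSum ∘ map toDigit) (words allSteps n))
  ≡⟨ sym (sum-words-relabel toDigit allSteps allDigits relabel-alphabet n _) ⟩
    sum (map (indicator isCountedSum) (words allDigits n))
  ≡⟨ sym (count≡sum-indicator isCountedSum (words allDigits n)) ⟩
    s n k
  ∎
  where
  isCountedPath : List Step → Bool
  isCountedPath p = peaklessᵇ p ∧ endsAtᵇ (+ k - + n) p

  isCountedSum : List Digit → Bool
  isCountedSum es = validᵇ es ∧ hasValueᵇ k es

  path≡digits : ∀ p → length p ≡ n →
    indicator isCountedPath p ≡ indicator isCountedSum (map toDigit p)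
  path≡digits p refl = cong (λ b → if b then 1 else 0)
    (cong₂ _∧_ (sym (valid-relabel p)) (endsAt-relabel k p))
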